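{- For all integers $6\le n\le m$, \[ \gamma_{2t}(K_n\Box K_m)\ge \min\big\{\gamma_{2t}(K_3\Box K_3)+\gamma_{2t}(K_{n-3}\Box K_{m-3}),\ \gamma_{2t}(K_4\Box K_4)+\gamma_{2t}(K_{n-4}\Box K_{m-4})\big\}. \]
   Context: $K_n$ denotes the complete graph on $n$ vertices. The Cartesian product $G\Box H$ has vertex set $V(G)\times V(H)$, with $(u_1,v_1)\sim(u_2,v_2)$ iff either $u_1=u_2$ and $v_1\sim v_2$, or $v_1=v_2$ and $u_1\sim u_2$. A set $S$ of vertices of a graph $G$ is total $2$-dominating if every vertex of $G$ is adjacent to at least two vertices of $S$; $\gamma_{2t}(G)$ is the minimum cardinality of such a set. -}

module Defs where

open import Data.Nat using (ℕ; zero; suc; _+_; _≤_)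
open import Data.Fin using (Fin; zero; suc)
open import Data.Bool using (Bool; true; false)
open import Data.Product using (_×_; ∃; ∃-syntax; _,_)
open import Data.Sum using (_⊎_)
open import Relation.Binary.PropositionalEquality using (_≡_; _≢_)

Vertex : ℕ → ℕ → Set
Vertex n m = Fin n × Fin m

Adj : ∀ {n m} → Vertex n m → Vertex n m → Set
Adj (i , j) (i' , j') = (i ≡ i' × j ≢ j') ⊎ (j ≡ j' × i ≢ i')

VSet : ℕ → ℕ → Set
VSet n m = Fin n → Fin m → Bool

_∈S_ : ∀ {n m} → Vertex n m → VSet n m → Set
(i , j) ∈S S = S i j ≡ true

sumFin : ∀ k → (Fin k → ℕ) → ℕ
sumFin zero    f = 0
sumFin (suc k) f = f zero + sumFin k (λ x → f (suc x))

b2n : Bool → ℕ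
b2n true  = 1
b2n false = 0

card : ∀ {n m} → VSet n m → ℕ
card {n} {m} S = sumFin n (λ i → sumFin m (λ j → b2n (S i j)))

IsTotal2Dom : ∀ {n m} → VSet n m → Set
IsTotal2Dom {n} {m} S =
  (v : Vertex n m) → ∃[ u ] ∃[ w ] (u ≢ w × u ∈S S × w ∈S S × Adj v u × Adj v w)

IsGamma2t : ℕ → ℕ → ℕ → Set
IsGamma2t n m k =
  (∃[ S ] (IsTotal2Dom {n} {m} S × card S ≡ k)) ×
  ((S : VSet n m) → IsTotal2Dom S → k ≤ card S)

-- A vertex set S of K_n □ K_m is total 2-dominating iff row S i + col S j ≥ 2 + 2·S(i,j) at every
-- cell. Sorting the lines by their number of entries (1, 2 or at least 3), and noting that the single
-- entry of a column lies in a row with at least three, gives: if no line is empty then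
-- 4|S| ≥ 3(n + m), with equality only if 3n = m + 8h; otherwise |S| ≥ 2n. Conversely, by induction
-- on c, every c below 2n and 2m that meets this bound is the size of a set without empty lines: split
-- off a full row of length 3, a full column of length 3 or their 4 × 4 block sum (each meets the
-- bound with equality), or take one long row and one long column; the cases c ≤ 5 are checked
-- exhaustively. So splitting the 4 × 4 block off an optimal set of K_n □ K_m leaves a realisable size
-- for K_{n-4} □ K_{m-4}, while 6 vertices suffice for K_4 □ K_4; when γ₂ₜ(K_n □ K_m) ≥ 2n − 2, two
-- full columns of K_{n-4} □ K_{m-4} suffice instead.

module Submission where

open import Data.Bool using (Bool; true; false)
open import Data.Empty using (⊥-elim)
open import Data.Fin using (Fin; zero; suc; punchIn; splitAt)
open import Data.Fin.Properties using (all?; any?; punchIn-injective; punchInᵢ≢i; punchIn-punchOut)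
open import Data.Nat using (ℕ; zero; suc; _+_; _*_; _∸_; _⊓_; _≤_; _<_; _≟_; _≤?_; _<?_; s≤s; z≤n)
open import Data.Nat.Induction using (<-rec)
open import Data.Nat.Properties
open import Algebra.Properties.CommutativeSemigroup +-commutativeSemigroup using (x∙yz≈y∙xz)
open import Data.Nat.Tactic.RingSolver using (solve-∀)
open import Data.Product using (_×_; _,_; proj₁; proj₂; ∃-syntax)
open import Data.Sum using (_⊎_; inj₁; inj₂; [_,_]′; map₁)
open import Function using (_∘_)
open import Relation.Binary.PropositionalEquality
open import Relation.Nullary using (Dec; yes; no; ¬_)
open import Relation.Nullary.Decidable using (_×-dec_; _⊎-dec_; _→-dec_; from-yes)

open import Defs

sumFin-cong : ∀ k {f g : Fin k → ℕ} → (∀ x → f x ≡ g x) → sumFin k f ≡ sumFin k g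
sumFin-cong zero    f≗g = refl
sumFin-cong (suc k) f≗g = cong₂ _+_ (f≗g zero) (sumFin-cong k (f≗g ∘ suc))

sumFin-mono : ∀ k {f g : Fin k → ℕ} → (∀ x → f x ≤ g x) → sumFin k f ≤ sumFin k g
sumFin-mono zero    f≤g = z≤n
sumFin-mono (suc k) f≤g = +-mono-≤ (f≤g zero) (sumFin-mono k (f≤g ∘ suc))

sumFin-const : ∀ k c → sumFin k (λ _ → c) ≡ k * c
sumFin-const zero    c = refl
sumFin-const (suc k) c = cong (c +_) (sumFin-const k c)

sumFin-punchIn : ∀ {k} (f : Fin (suc k) → ℕ) x → sumFin (suc k) f ≡ f x + sumFin k (f ∘ punchIn x)
sumFin-punchIn         f zero    = refl
sumFin-punchIn {suc k} f (suc x) = begin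
  f zero + sumFin (suc k) (f ∘ suc)                      ≡⟨ cong (f zero +_) (sumFin-punchIn (f ∘ suc) x) ⟩
  f zero + (f (suc x) + sumFin k (f ∘ suc ∘ punchIn x))  ≡⟨ x∙yz≈y∙xz (f zero) (f (suc x)) _ ⟩
  f (suc x) + (f zero + sumFin k (f ∘ suc ∘ punchIn x))  ∎
  where open ≡-Reasoning

sumFin-zero : ∀ k → sumFin k (λ _ → 0) ≡ 0
sumFin-zero k = trans (sumFin-const k 0) (*-zeroʳ k)

sumFin-+ : ∀ k (f g : Fin k → ℕ) → sumFin k (λ x → f x + g x) ≡ sumFin k f + sumFin k g
sumFin-+ zero    f g = refl
sumFin-+ (suc k) f g = begin
  (f zero + g zero) + sumFin k (λ x → f (suc x) + g (suc x))          ≡⟨ cong (f zero + g zero +_) (sumFin-+ k (f ∘ suc) (g ∘ suc)) ⟩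
  (f zero + g zero) + (sumFin k (f ∘ suc) + sumFin k (g ∘ suc))       ≡⟨ regroup (f zero) (g zero) _ _ ⟩
  (f zero + sumFin k (f ∘ suc)) + (g zero + sumFin k (g ∘ suc))       ∎
  where
  open ≡-Reasoning
  regroup : ∀ a b c d → (a + b) + (c + d) ≡ (a + c) + (b + d)
  regroup = solve-∀

sumFin-swap : ∀ n m (f : Fin n → Fin m → ℕ) →
  sumFin n (λ i → sumFin m (f i)) ≡ sumFin m (λ j → sumFin n (λ i → f i j))
sumFin-swap zero    m f = sym (sumFin-zero m)
sumFin-swap (suc n) m f = begin
  sumFin m (f zero) + sumFin n (λ i → sumFin m (f (suc i)))           ≡⟨ cong (sumFin m (f zero) +_) (sumFin-swap n m (f ∘ suc)) ⟩
  sumFin m (f zero) + sumFin m (λ j → sumFin n (λ i → f (suc i) j))   ≡⟨ sumFin-+ m (f zero) _ ⟨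
  sumFin m (λ j → f zero j + sumFin n (λ i → f (suc i) j))            ∎
  where open ≡-Reasoning

sumFin-splitAt : ∀ b d (f : Fin b ⊎ Fin d → ℕ) →
  sumFin (b + d) (f ∘ splitAt b) ≡ sumFin b (f ∘ inj₁) + sumFin d (f ∘ inj₂)
sumFin-splitAt zero    d f = refl
sumFin-splitAt (suc b) d f =
  trans (cong (f (inj₁ zero) +_) (sumFin-splitAt b d (f ∘ map₁ suc))) (sym (+-assoc (f (inj₁ zero)) _ _))

sumFin-*ˡ : ∀ k c (f : Fin k → ℕ) → sumFin k (λ x → c * f x) ≡ c * sumFin k f
sumFin-*ˡ zero    c f = sym (*-zeroʳ c)
sumFin-*ˡ (suc k) c f = trans (cong (c * f zero +_) (sumFin-*ˡ k c (f ∘ suc))) (sym (*-distribˡ-+ c (f zero) _))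

const≤sumFin : ∀ k {c} (f : Fin k → ℕ) → (∀ x → c ≤ f x) → k * c ≤ sumFin k f
const≤sumFin k {c} f c≤f = ≤-trans (≤-reflexive (sym (sumFin-const k c))) (sumFin-mono k c≤f)

count : ∀ {k} → (Fin k → Bool) → ℕ
count {k} g = sumFin k (λ x → b2n (g x))

count-true : ∀ k → count {k} (λ _ → true) ≡ k
count-true k = trans (sumFin-const k 1) (*-identityʳ k)

count-punchIn : ∀ {k} (g : Fin (suc k) → Bool) a → count g ≡ b2n (g a) + count (g ∘ punchIn a)
count-punchIn g = sumFin-punchIn (b2n ∘ g)

entry≤count : ∀ {k} (g : Fin k → Bool) a → b2n (g a) ≤ count g
entry≤count {suc k} g a = ≤-trans (m≤m+n _ _) (≤-reflexive (sym (count-punchIn g a)))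

count-without≥⇒count≥ : ∀ {k} (g : Fin (suc k) → Bool) a {t} →
  t ≤ count (g ∘ punchIn a) → t + b2n (g a) ≤ count g
count-without≥⇒count≥ g a {t} t≤ = begin
  t + b2n (g a)                     ≡⟨ +-comm t _ ⟩
  b2n (g a) + t                     ≤⟨ +-monoʳ-≤ (b2n (g a)) t≤ ⟩
  b2n (g a) + count (g ∘ punchIn a) ≡⟨ count-punchIn g a ⟨
  count g                           ∎
  where open ≤-Reasoning

count≥⇒count-without≥ : ∀ {k} (g : Fin (suc k) → Bool) a {t} →
  t + b2n (g a) ≤ count g → t ≤ count (g ∘ punchIn a)
count≥⇒count-without≥ g a {t} t+≤ = +-cancelˡ-≤ (b2n (g a)) t _ (begin
  b2n (g a) + t                     ≡⟨ +-comm _ t ⟩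
  t + b2n (g a)                     ≤⟨ t+≤ ⟩
  count g                           ≡⟨ count-punchIn g a ⟩
  b2n (g a) + count (g ∘ punchIn a) ∎)
  where open ≤-Reasoning

punchIn-preimage : ∀ {k} {a b : Fin (suc k)} → b ≢ a → ∃[ b′ ] punchIn a b′ ≡ b
punchIn-preimage b≢a = _ , punchIn-punchOut (b≢a ∘ sym)

count≥1 : ∀ {k} (g : Fin k → Bool) {b} → g b ≡ true → 1 ≤ count g
count≥1 g {b} gb = ≤-trans (≤-reflexive (cong b2n (sym gb))) (entry≤count g b)

count≥1⇒∃ : ∀ {k} (g : Fin k → Bool) → 1 ≤ count g → ∃[ b ] g b ≡ true
count≥1⇒∃ {suc k} g 1≤ with g zero in g0
... | true  = zero , g0
... | false with count≥1⇒∃ (g ∘ suc) 1≤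
...   | b , gb = suc b , gb

count≥2 : ∀ {k} (g : Fin k → Bool) {b c} → b ≢ c → g b ≡ true → g c ≡ true → 2 ≤ count g
count≥2 {suc k} g {b} {c} b≢c gb gc with punchIn-preimage b≢c
... | b′ , refl = subst (λ x → 1 + b2n x ≤ count g) gc
                    (count-without≥⇒count≥ g c (count≥1 (g ∘ punchIn c) gb))

count≥2⇒∃ : ∀ {k} (g : Fin k → Bool) → 2 ≤ count g → ∃[ b ] ∃[ c ] b ≢ c × g b ≡ true × g c ≡ true
count≥2⇒∃ {suc k} g 2≤ with count≥1⇒∃ g (≤-trans (s≤s z≤n) 2≤)
... | b , gb with count≥1⇒∃ (g ∘ punchIn b) (count≥⇒count-without≥ g b (subst (λ x → 1 + b2n x ≤ count g) (sym gb) 2≤))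
...   | c′ , gc = b , punchIn b c′ , (punchInᵢ≢i b c′ ∘ sym) , gb , gc

count-other : ∀ {k} (g : Fin k → Bool) {a b} → b ≢ a → g b ≡ true → 1 + b2n (g a) ≤ count g
count-other {suc k} g {a} b≢a gb with punchIn-preimage b≢a
... | b′ , refl = count-without≥⇒count≥ g a (count≥1 (g ∘ punchIn a) gb)

count-other⇒∃ : ∀ {k} (g : Fin k → Bool) a → 1 + b2n (g a) ≤ count g → ∃[ b ] b ≢ a × g b ≡ true
count-other⇒∃ {suc k} g a ≤c with count≥1⇒∃ (g ∘ punchIn a) (count≥⇒count-without≥ g a ≤c)
... | b′ , gb = punchIn a b′ , punchInᵢ≢i a b′ , gb

count-others : ∀ {k} (g : Fin k → Bool) {a b c} → b ≢ c → b ≢ a → c ≢ a →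
  g b ≡ true → g c ≡ true → 2 + b2n (g a) ≤ count g
count-others {suc k} g {a} b≢c b≢a c≢a gb gc with punchIn-preimage b≢a | punchIn-preimage c≢a
... | b′ , refl | c′ , refl =
  count-without≥⇒count≥ g a (count≥2 (g ∘ punchIn a) (b≢c ∘ cong (punchIn a)) gb gc)

count-others⇒∃ : ∀ {k} (g : Fin k → Bool) a → 2 + b2n (g a) ≤ count g →
  ∃[ b ] ∃[ c ] b ≢ c × b ≢ a × c ≢ a × g b ≡ true × g c ≡ true
count-others⇒∃ {suc k} g a ≤c with count≥2⇒∃ (g ∘ punchIn a) (count≥⇒count-without≥ g a ≤c)
... | b′ , c′ , b′≢c′ , gb , gc =
  punchIn a b′ , punchIn a c′ , b′≢c′ ∘ punchIn-injective a b′ c′ ,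
  punchInᵢ≢i a b′ , punchInᵢ≢i a c′ , gb , gc

-- Total 2-domination through line counts

module _ {n m : ℕ} where

  row : VSet n m → Fin n → ℕ
  row S i = count (S i)

  col : VSet n m → Fin m → ℕ
  col S j = count (λ i → S i j)

  -- The neighbours of (i , j) in S are its entries in row i and column j other than (i , j) itself.
  RowColDominating : VSet n m → Set
  RowColDominating S = ∀ i j → 2 + b2n (S i j) + b2n (S i j) ≤ row S i + col S j

private
  cross-bound : ∀ s {R C} → 1 + s ≤ R → 1 + s ≤ C → 2 + s + s ≤ R + C
  cross-bound s R≥ C≥ = ≤-trans (≤-reflexive (cong suc (sym (+-suc s s)))) (+-mono-≤ R≥ C≥)

  other-half : ∀ s {R C} → 2 + s + s ≤ R + C → R ≤ 1 + s → 1 + s ≤ C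
  other-half s {R} {C} ≤R+C R≤ = +-cancelˡ-≤ (1 + s) _ _ (begin
    (1 + s) + (1 + s) ≡⟨ cong suc (+-suc s s) ⟩
    2 + s + s         ≤⟨ ≤R+C ⟩
    R + C             ≤⟨ +-monoˡ-≤ C R≤ ⟩
    (1 + s) + C       ∎)
    where open ≤-Reasoning

total2Dom⇒rowColDominating : ∀ {n m} (S : VSet n m) → IsTotal2Dom S → RowColDominating S
total2Dom⇒rowColDominating S dom i j with dom (i , j)
... | (_ , j₁) , (_ , j₂) , u≢w , u∈S , w∈S , inj₁ (refl , j≢j₁) , inj₁ (refl , j≢j₂) =
  +-mono-≤ (count-others (S i) (u≢w ∘ cong (i ,_)) (j≢j₁ ∘ sym) (j≢j₂ ∘ sym) u∈S w∈S)
           (entry≤count (λ x → S x j) i)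
... | (_ , j₁) , (i₂ , _) , _ , u∈S , w∈S , inj₁ (refl , j≢j₁) , inj₂ (refl , i≢i₂) =
  cross-bound (b2n (S i j)) (count-other (S i) (j≢j₁ ∘ sym) u∈S) (count-other (λ x → S x j) (i≢i₂ ∘ sym) w∈S)
... | (i₁ , _) , (_ , j₂) , _ , u∈S , w∈S , inj₂ (refl , i≢i₁) , inj₁ (refl , j≢j₂) =
  cross-bound (b2n (S i j)) (count-other (S i) (j≢j₂ ∘ sym) w∈S) (count-other (λ x → S x j) (i≢i₁ ∘ sym) u∈S)
... | (i₁ , _) , (i₂ , _) , u≢w , u∈S , w∈S , inj₂ (refl , i≢i₁) , inj₂ (refl , i≢i₂) =
  ≤-trans (≤-reflexive (+-comm (2 + b2n (S i j)) _))
    (+-mono-≤ (entry≤count (S i) j)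
              (count-others (λ x → S x j) (u≢w ∘ cong (_, j)) (i≢i₁ ∘ sym) (i≢i₂ ∘ sym) u∈S w∈S))

rowColDominating⇒total2Dom : ∀ {n m} (S : VSet n m) → RowColDominating S → IsTotal2Dom S
rowColDominating⇒total2Dom S dom (i , j) with 2 + b2n (S i j) ≤? row S i | 2 + b2n (S i j) ≤? col S j
... | yes ≤row | _ with count-others⇒∃ (S i) j ≤row
...   | b , c , b≢c , b≢j , c≢j , Sb , Sc =
  (i , b) , (i , c) , b≢c ∘ cong proj₂ , Sb , Sc , inj₁ (refl , b≢j ∘ sym) , inj₁ (refl , c≢j ∘ sym)
rowColDominating⇒total2Dom S dom (i , j) | no _ | yes ≤col with count-others⇒∃ (λ x → S x j) i ≤col
...   | b , c , b≢c , b≢i , c≢i , Sb , Sc =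
  (b , j) , (c , j) , b≢c ∘ cong proj₁ , Sb , Sc , inj₂ (refl , b≢i ∘ sym) , inj₂ (refl , c≢i ∘ sym)
rowColDominating⇒total2Dom S dom (i , j) | no ≰row | no ≰col
  with count-other⇒∃ (S i) j (other-half s (≤-trans (dom i j) (≤-reflexive (+-comm (row S i) (col S j)))) (≤-pred (≰⇒> ≰col)))
     | count-other⇒∃ (λ x → S x j) i (other-half s (dom i j) (≤-pred (≰⇒> ≰row)))
  where s = b2n (S i j)
... | b , b≢j , Sb | c , c≢i , Sc =
  (i , b) , (c , j) , c≢i ∘ sym ∘ cong proj₁ , Sb , Sc , inj₁ (refl , b≢j ∘ sym) , inj₂ (refl , c≢i ∘ sym)

transpose : ∀ {n m} → VSet n m → VSet m n
transpose S j i = S i j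

card-transpose : ∀ {n m} (S : VSet n m) → card (transpose S) ≡ card S
card-transpose {n} {m} S = sym (sumFin-swap n m (λ i j → b2n (S i j)))

rowColDominating-transpose : ∀ {n m} {S : VSet n m} → RowColDominating S → RowColDominating (transpose S)
rowColDominating-transpose {S = S} dom j i = ≤-trans (dom i j) (≤-reflexive (+-comm (row S i) (col S j)))

NoEmptyLine : ∀ {n m} → VSet n m → Set
NoEmptyLine S = (∀ i → 1 ≤ row S i) × (∀ j → 1 ≤ col S j)

Realisable : ℕ → ℕ → ℕ → Set
Realisable a b c = ∃[ S ] RowColDominating {a} {b} S × NoEmptyLine S × card S ≤ c

realisable-mono : ∀ {a b c c′} → c ≤ c′ → Realisable a b c → Realisable a b c′
realisable-mono c≤c′ (S , dom , ne , card≤) = S , dom , ne , ≤-trans card≤ c≤c′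

realisable-transpose : ∀ {a b c} → Realisable a b c → Realisable b a c
realisable-transpose (S , dom , (rows , cols) , card≤) =
  transpose S , rowColDominating-transpose dom , (cols , rows) , ≤-trans (≤-reflexive (card-transpose S)) card≤

module _ {a b c d : ℕ} (A : VSet a b) (B : VSet c d) where

  blocks : Fin a ⊎ Fin c → Fin b ⊎ Fin d → Bool
  blocks (inj₁ i) (inj₁ j) = A i j
  blocks (inj₂ i) (inj₂ j) = B i j
  blocks _        _        = false

  _⊕_ : VSet (a + c) (b + d)
  _⊕_ i j = blocks (splitAt a i) (splitAt b j)

  blockRow : Fin a ⊎ Fin c → ℕ
  blockRow = [ row A , row B ]′

  blockCol : Fin b ⊎ Fin d → ℕ
  blockCol = [ col A , col B ]′

  row-⊕ : ∀ i → row _⊕_ i ≡ blockRow (splitAt a i)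
  row-⊕ i = trans (sumFin-splitAt b d (λ y → b2n (blocks (splitAt a i) y))) (split (splitAt a i))
    where
    split : ∀ x → sumFin b (λ j → b2n (blocks x (inj₁ j))) + sumFin d (λ j → b2n (blocks x (inj₂ j))) ≡ blockRow x
    split (inj₁ i) = trans (cong (row A i +_) (sumFin-zero d)) (+-identityʳ _)
    split (inj₂ i) = cong (_+ row B i) (sumFin-zero b)

  col-⊕ : ∀ j → col _⊕_ j ≡ blockCol (splitAt b j)
  col-⊕ j = trans (sumFin-splitAt a c (λ x → b2n (blocks x (splitAt b j)))) (split (splitAt b j))
    where
    split : ∀ y → sumFin a (λ i → b2n (blocks (inj₁ i) y)) + sumFin c (λ i → b2n (blocks (inj₂ i) y)) ≡ blockCol y
    split (inj₁ j) = trans (cong (col A j +_) (sumFin-zero c)) (+-identityʳ _)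
    split (inj₂ j) = cong (_+ col B j) (sumFin-zero a)

  card-⊕ : card _⊕_ ≡ card A + card B
  card-⊕ = trans (sumFin-cong (a + c) row-⊕) (sumFin-splitAt a c blockRow)

  module _ (domA : RowColDominating A) (neA : NoEmptyLine A)
           (domB : RowColDominating B) (neB : NoEmptyLine B) where

    rowColDominating-⊕ : RowColDominating _⊕_
    rowColDominating-⊕ i j =
      ≤-trans (dom-blocks (splitAt a i) (splitAt b j)) (≤-reflexive (sym (cong₂ _+_ (row-⊕ i) (col-⊕ j))))
      where
      dom-blocks : ∀ x y → 2 + b2n (blocks x y) + b2n (blocks x y) ≤ blockRow x + blockCol y
      dom-blocks (inj₁ i) (inj₁ j) = domA i j
      dom-blocks (inj₁ i) (inj₂ j) = +-mono-≤ (proj₁ neA i) (proj₂ neB j)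
      dom-blocks (inj₂ i) (inj₁ j) = +-mono-≤ (proj₁ neB i) (proj₂ neA j)
      dom-blocks (inj₂ i) (inj₂ j) = domB i j

    noEmptyLine-⊕ : NoEmptyLine _⊕_
    noEmptyLine-⊕ = (λ i → ≤-trans (rows (splitAt a i)) (≤-reflexive (sym (row-⊕ i))))
                  , (λ j → ≤-trans (cols (splitAt b j)) (≤-reflexive (sym (col-⊕ j))))
      where
      rows : ∀ x → 1 ≤ blockRow x
      rows (inj₁ i) = proj₁ neA i
      rows (inj₂ i) = proj₁ neB i
      cols : ∀ y → 1 ≤ blockCol y
      cols (inj₁ j) = proj₂ neA j
      cols (inj₂ j) = proj₂ neB j

realisable-⊕ : ∀ {a b c a′ b′ c′} → Realisable a b c → Realisable a′ b′ c′ → Realisable (a + a′) (b + b′) (c + c′)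
realisable-⊕ (A , domA , neA , cardA) (B , domB , neB , cardB) =
  A ⊕ B , rowColDominating-⊕ A B domA neA domB neB , noEmptyLine-⊕ A B domA neA domB neB ,
  ≤-trans (≤-reflexive (card-⊕ A B)) (+-mono-≤ cardA cardB)

fullRow : ∀ x → VSet 1 x
fullRow x _ _ = true

realisable-fullRow : ∀ {x} → 3 ≤ x → Realisable 1 x x
realisable-fullRow {x} 3≤x = fullRow x , dom , (rows , λ _ → s≤s z≤n) , ≤-reflexive card≡
  where
  dom : RowColDominating (fullRow x)
  dom zero j = ≤-trans (+-monoˡ-≤ 1 3≤x) (≤-reflexive (cong (_+ 1) (sym (count-true x))))
  rows : ∀ i → 1 ≤ row (fullRow x) i
  rows zero = ≤-trans (≤-trans (s≤s z≤n) 3≤x) (≤-reflexive (sym (count-true x)))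
  card≡ : card (fullRow x) ≡ x
  card≡ = trans (+-identityʳ _) (count-true x)

realisable-fullColumn : ∀ {x} → 3 ≤ x → Realisable x 1 x
realisable-fullColumn = realisable-transpose ∘ realisable-fullRow

realisable-twoLines : ∀ {a b} → 3 ≤ a → 3 ≤ b → Realisable (suc a) (suc b) (a + b)
realisable-twoLines {a} {b} 3≤a 3≤b =
  subst₂ (Realisable (suc a)) (+-comm b 1) (+-comm b a)
    (realisable-⊕ (realisable-fullRow 3≤b) (realisable-fullColumn 3≤a))

rowColDominating? : ∀ {n m} (S : VSet n m) → Dec (RowColDominating S)
rowColDominating? S = all? λ i → all? λ j → _ ≤? _

noEmptyLine? : ∀ {n m} (S : VSet n m) → Dec (NoEmptyLine S)
noEmptyLine? S = all? (λ i → 1 ≤? row S i) ×-dec all? (λ j → 1 ≤? col S j)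

tee : VSet 3 3
tee zero          _               = true
tee (suc _)       (suc (suc zero)) = true
tee (suc _)       _               = false

realisable-tee : Realisable 3 3 5
realisable-tee = tee , from-yes (rowColDominating? tee) , from-yes (noEmptyLine? tee) , ≤-refl

twoColumns : ∀ a b → VSet a (2 + b)
twoColumns a b i zero          = true
twoColumns a b i (suc zero)    = true
twoColumns a b i (suc (suc j)) = false

twoColumns-total2Dom : ∀ {a} b → 2 ≤ a → IsTotal2Dom (twoColumns a b)
twoColumns-total2Dom {a} b 2≤a = rowColDominating⇒total2Dom (twoColumns a b) dom
  where
  dom : RowColDominating (twoColumns a b)
  dom i zero          rewrite sumFin-zero b | count-true a = +-monoʳ-≤ 2 2≤a
  dom i (suc zero)    rewrite sumFin-zero b | count-true a = +-monoʳ-≤ 2 2≤a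
  dom i (suc (suc j)) rewrite sumFin-zero b | sumFin-zero a = ≤-refl

card-twoColumns : ∀ a b → card (twoColumns a b) ≡ a * 2
card-twoColumns a b = trans (sumFin-cong a (λ _ → cong (λ z → 1 + (1 + z)) (sumFin-zero b))) (sumFin-const a 2)

-- The counting lower bound

record CountBound (a b c : ℕ) : Set where
  constructor countBound
  field
    slack    : ℕ
    slack-eq : 4 * c ≡ 3 * (a + b) + slack
    tight    : slack ≡ 0 → ∃[ h ] 3 * a ≡ b + 8 * h

isLight isMedium isHeavy : ℕ → ℕ
isLight 1 = 1
isLight _ = 0
isMedium 2 = 1
isMedium _ = 0
isHeavy (suc (suc (suc _))) = 1
isHeavy _ = 0

classes≡1 : ∀ {r} → 1 ≤ r → isLight r + isMedium r + isHeavy r ≡ 1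
classes≡1 {1}                 _ = refl
classes≡1 {2}                 _ = refl
classes≡1 {suc (suc (suc r))} _ = refl

classes-weighted : ∀ {r} → 1 ≤ r → isLight r + 2 * isMedium r + isHeavy r * r ≡ r
classes-weighted {1}                 _ = refl
classes-weighted {2}                 _ = refl
classes-weighted {suc (suc (suc r))} _ = +-identityʳ _

3*isHeavy≤ : ∀ r → 3 * isHeavy r ≤ isHeavy r * r
3*isHeavy≤ (suc (suc (suc r))) = +-monoʳ-≤ 3 z≤n
3*isHeavy≤ 0 = z≤n
3*isHeavy≤ 1 = z≤n
3*isHeavy≤ 2 = z≤n

isLight*≡ : ∀ c → isLight c * c ≡ isLight c
isLight*≡ 1                 = refl
isLight*≡ 0                 = refl
isLight*≡ (suc (suc c))     = refl

isLight≤isHeavy : ∀ r c → 4 ≤ r + c → isLight c ≤ isHeavy r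
isLight≤isHeavy r                   0             _ = z≤n
isLight≤isHeavy r                   (suc (suc c)) _ = z≤n
isLight≤isHeavy (suc (suc (suc r))) 1             _ = ≤-refl
isLight≤isHeavy 0                   1             (s≤s ())
isLight≤isHeavy 1                   1             (s≤s (s≤s ()))
isLight≤isHeavy 2                   1             (s≤s (s≤s (s≤s ())))

record LineClasses : Set where
  constructor classes
  field light medium heavy heavyMass : ℕ

classify : ∀ {n} → (Fin n → ℕ) → LineClasses
classify {n} r = classes (sumFin n (isLight ∘ r)) (sumFin n (isMedium ∘ r)) (sumFin n (isHeavy ∘ r))
                         (sumFin n (λ i → isHeavy (r i) * r i))

Describes : LineClasses → ℕ → ℕ → Set
Describes (classes L M H P) lines total = lines ≡ L + M + H × total ≡ L + 2 * M + P × 3 * H ≤ P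

classify-describes : ∀ {n} (r : Fin n → ℕ) → (∀ i → 1 ≤ r i) → Describes (classify r) n (sumFin n r)
classify-describes {n} r 1≤r = lines≡ , total≡ , heavy≤
  where
  open ≡-Reasoning
  light medium heavy mass : Fin n → ℕ
  light  = isLight ∘ r
  medium = isMedium ∘ r
  heavy  = isHeavy ∘ r
  mass i = heavy i * r i
  lines≡ : n ≡ sumFin n light + sumFin n medium + sumFin n heavy
  lines≡ = begin
    n                                                    ≡⟨ trans (sumFin-const n 1) (*-identityʳ n) ⟨
    sumFin n (λ _ → 1)                                   ≡⟨ sumFin-cong n (classes≡1 ∘ 1≤r) ⟨
    sumFin n (λ i → light i + medium i + heavy i)        ≡⟨ sumFin-+ n (λ i → light i + medium i) heavy ⟩
    sumFin n (λ i → light i + medium i) + sumFin n heavy ≡⟨ cong (_+ sumFin n heavy) (sumFin-+ n light medium) ⟩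
    sumFin n light + sumFin n medium + sumFin n heavy    ∎
  total≡ : sumFin n r ≡ sumFin n light + 2 * sumFin n medium + sumFin n mass
  total≡ = begin
    sumFin n r                                                    ≡⟨ sumFin-cong n (classes-weighted ∘ 1≤r) ⟨
    sumFin n (λ i → light i + 2 * medium i + mass i)              ≡⟨ sumFin-+ n (λ i → light i + 2 * medium i) mass ⟩
    sumFin n (λ i → light i + 2 * medium i) + sumFin n mass       ≡⟨ cong (_+ sumFin n mass) (sumFin-+ n light (λ i → 2 * medium i)) ⟩
    sumFin n light + sumFin n (λ i → 2 * medium i) + sumFin n mass ≡⟨ cong (λ x → sumFin n light + x + sumFin n mass) (sumFin-*ˡ n 2 medium) ⟩
    sumFin n light + 2 * sumFin n medium + sumFin n mass          ∎
  heavy≤ : 3 * sumFin n heavy ≤ sumFin n mass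
  heavy≤ = ≤-trans (≤-reflexive (sym (sumFin-*ˡ n 3 heavy))) (sumFin-mono n (3*isHeavy≤ ∘ r))

lightColumns≤heavyRowMass : ∀ {n m} (S : VSet n m) → RowColDominating S →
  LineClasses.light (classify (col S)) ≤ LineClasses.heavyMass (classify (row S))
lightColumns≤heavyRowMass {n} {m} S dom = begin
  sumFin m (λ j → isLight (col S j))                                   ≡⟨ sumFin-cong m (isLight*≡ ∘ col S) ⟨
  sumFin m (λ j → isLight (col S j) * col S j)                          ≡⟨ sumFin-cong m (λ j → sumFin-*ˡ n (isLight (col S j)) (λ i → b2n (S i j))) ⟨
  sumFin m (λ j → sumFin n (λ i → isLight (col S j) * b2n (S i j)))    ≡⟨ sumFin-swap n m (λ i j → isLight (col S j) * b2n (S i j)) ⟨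
  sumFin n (λ i → sumFin m (λ j → isLight (col S j) * b2n (S i j)))    ≤⟨ sumFin-mono n (λ i → sumFin-mono m (entry i)) ⟩
  sumFin n (λ i → sumFin m (λ j → isHeavy (row S i) * b2n (S i j)))    ≡⟨ sumFin-cong n (λ i → sumFin-*ˡ m (isHeavy (row S i)) (λ j → b2n (S i j))) ⟩
  sumFin n (λ i → isHeavy (row S i) * row S i)                          ∎
  where
  open ≤-Reasoning
  entry : ∀ i j → isLight (col S j) * b2n (S i j) ≤ isHeavy (row S i) * b2n (S i j)
  entry i j with S i j | dom i j
  ... | true  | 4≤ = *-monoˡ-≤ 1 (isLight≤isHeavy (row S i) (col S j) 4≤)
  ... | false | _  = ≤-reflexive (trans (*-zeroʳ (isLight (col S j))) (sym (*-zeroʳ (isHeavy (row S i)))))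

private
  tightness : ∀ LR HR LC HC MR MC x₁ y₁ x₂ y₂ → LC + y₁ ≡ 3 * HR + x₁ → LR + y₂ ≡ 3 * HC + x₂ →
    MR + MC + x₁ + y₁ + x₂ + y₂ ≡ 0 → ∃[ h ] 3 * (LR + MR + HR) ≡ LC + MC + HC + 8 * h
  tightness LR HR LC HC 0 0 0 0 0 0 LC≡ LR≡ _ = HC , (begin
    3 * (LR + 0 + HR)          ≡⟨ cong (λ l → 3 * (l + HR)) LR≡ ⟩
    3 * (3 * HC + 0 + HR)      ≡⟨ regroup HR HC ⟩
    3 * HR + 0 + HC + 8 * HC   ≡⟨ cong (λ l → l + HC + 8 * HC) LC≡ ⟨
    LC + 0 + HC + 8 * HC       ∎)
    where
    open ≡-Reasoning
    regroup : ∀ HR HC → 3 * (3 * HC + 0 + HR) ≡ 3 * HR + 0 + HC + 8 * HC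
    regroup = solve-∀
  tightness _ _ _ _ (suc _) _       _       _       _       _       _ _ ()
  tightness _ _ _ _ 0       (suc _) _       _       _       _       _ _ ()
  tightness _ _ _ _ 0       0       (suc _) _       _       _       _ _ ()
  tightness _ _ _ _ 0       0       0       (suc _) _       _       _ _ ()
  tightness _ _ _ _ 0       0       0       0       (suc _) _       _ _ ()
  tightness _ _ _ _ 0       0       0       0       0       (suc _) _ _ ()

-- 4k = 2k + 2k, and in each 2k = 2L + 4M + 2P one P is bounded by 3H and the other by the light lines
-- of the other direction; the slack collects the medium lines and the two excesses.
countBound-of-classes : ∀ {n m k R C} → Describes R n k → Describes C m k →
  LineClasses.light C ≤ LineClasses.heavyMass R → LineClasses.light R ≤ LineClasses.heavyMass C →
  CountBound n m k
countBound-of-classes {R = classes LR MR HR _} {C = classes LC MC HC _}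
                      (refl , refl , 3HR≤PR) (refl , k≡ , 3HC≤PC) LC≤PR LR≤PC
  with m≤n⇒∃[o]m+o≡n 3HR≤PR | m≤n⇒∃[o]m+o≡n 3HC≤PC
... | x₁ , refl | x₂ , refl with m≤n⇒∃[o]m+o≡n LC≤PR | m≤n⇒∃[o]m+o≡n LR≤PC
...   | y₁ , y₁≡ | y₂ , y₂≡ =
  countBound (MR + MC + x₁ + y₁ + x₂ + y₂) 4k≡ (tightness LR HR LC HC MR MC x₁ y₁ x₂ y₂ y₁≡ y₂≡)
  where
  open ≡-Reasoning
  k = LR + 2 * MR + (3 * HR + x₁)
  double : ∀ k → 4 * k ≡ (k + k) + (k + k)
  double = solve-∀
  key : ∀ LR MR HR LC MC HC x₁ y₁ x₂ y₂ →
    (LR + 2 * MR + (3 * HR + x₁)) + (LR + 2 * MR + (LC + y₁)) +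
    ((LC + 2 * MC + (3 * HC + x₂)) + (LC + 2 * MC + (LR + y₂)))
    ≡ 3 * ((LR + MR + HR) + (LC + MC + HC)) + (MR + MC + x₁ + y₁ + x₂ + y₂)
  key = solve-∀
  4k≡ : 4 * k ≡ 3 * ((LR + MR + HR) + (LC + MC + HC)) + (MR + MC + x₁ + y₁ + x₂ + y₂)
  4k≡ = begin
    4 * k                                                      ≡⟨ double k ⟩
    (k + k) + (k + k)                                          ≡⟨ cong (λ p → (k + (LR + 2 * MR + p)) + (k + k)) y₁≡ ⟨
    (k + (LR + 2 * MR + (LC + y₁))) + (k + k)                  ≡⟨ cong₂ (λ p q → (k + (LR + 2 * MR + (LC + y₁))) + (p + q)) k≡ k≡ ⟩
    (k + (LR + 2 * MR + (LC + y₁))) +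
      ((LC + 2 * MC + (3 * HC + x₂)) + (LC + 2 * MC + (3 * HC + x₂)))
        ≡⟨ cong (λ p → (k + (LR + 2 * MR + (LC + y₁))) + ((LC + 2 * MC + (3 * HC + x₂)) + (LC + 2 * MC + p))) y₂≡ ⟨
    (k + (LR + 2 * MR + (LC + y₁))) +
      ((LC + 2 * MC + (3 * HC + x₂)) + (LC + 2 * MC + (LR + y₂)))
        ≡⟨ key LR MR HR LC MC HC x₁ y₁ x₂ y₂ ⟩
    3 * ((LR + MR + HR) + (LC + MC + HC)) + (MR + MC + x₁ + y₁ + x₂ + y₂) ∎

countBound-of-noEmptyLine : ∀ {n m} (S : VSet n m) → RowColDominating S → NoEmptyLine S → CountBound n m (card S)
countBound-of-noEmptyLine {n} {m} S dom (rows , cols) =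
  countBound-of-classes {R = classify (row S)} {C = classify (col S)} (classify-describes (row S) rows)
                        (subst (Describes (classify (col S)) m) (card-transpose S) (classify-describes (col S) cols))
                        (lightColumns≤heavyRowMass S dom)
                        (lightColumns≤heavyRowMass (transpose S) (rowColDominating-transpose dom))

emptyRow⇒fullColumns : ∀ {n m} (S : VSet n m) → RowColDominating S → ∀ {i} → row S i ≡ 0 → ∀ j → 2 ≤ col S j
emptyRow⇒fullColumns S dom {i} empty j =
  ≤-trans (m≤m+n 2 (s + s)) (≤-trans (dom i j) (≤-reflexive (cong (_+ col S j) empty)))
  where s = b2n (S i j)

lowerBound : ∀ {n m} (S : VSet n m) → RowColDominating S → n ≤ m → 2 * n ≤ card S ⊎ CountBound n m (card S)
lowerBound {n} {m} S dom n≤m with any? (λ i → row S i ≟ 0) | any? (λ j → col S j ≟ 0)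
... | yes (i , empty) | _ = inj₁ (begin
  2 * n              ≤⟨ *-monoʳ-≤ 2 n≤m ⟩
  2 * m              ≡⟨ *-comm 2 m ⟩
  m * 2              ≤⟨ const≤sumFin m (col S) (emptyRow⇒fullColumns S dom empty) ⟩
  card (transpose S) ≡⟨ card-transpose S ⟩
  card S             ∎)
  where open ≤-Reasoning
... | no _ | yes (j , empty) = inj₁ (≤-trans (≤-reflexive (*-comm 2 n))
  (const≤sumFin n (row S) (emptyRow⇒fullColumns (transpose S) (rowColDominating-transpose dom) empty)))
... | no ¬emptyRow | no ¬emptyCol = inj₂ (countBound-of-noEmptyLine S dom
  ((λ i → n≢0⇒n>0 (λ e → ¬emptyRow (i , e))) , (λ j → n≢0⇒n>0 (λ e → ¬emptyCol (j , e)))))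

-- Realising the counting bound

countBound⇒≤ : ∀ {a b c} → CountBound a b c → 3 * (a + b) ≤ 4 * c
countBound⇒≤ (countBound D eq _) = ≤-trans (m≤m+n _ D) (≤-reflexive (sym eq))

tight-witness-positive : ∀ {a b c h} → 3 * (a + b) ≤ 4 * c → c < 2 * a → 3 * a ≡ b + 8 * h → 1 ≤ h
tight-witness-positive {h = suc h} _ _ _ = s≤s z≤n
tight-witness-positive {a} {b} {c} {zero} ≤4c c<2a 3a≡b = ⊥-elim (<-irrefl refl (begin-strict
  3 * a  ≤⟨ *-cancelˡ-≤ 4 (≤-trans (≤-reflexive (twelve a b (trans 3a≡b (+-identityʳ b)))) ≤4c) ⟩
  c      <⟨ c<2a ⟩
  2 * a  ≤⟨ *-monoˡ-≤ a (n≤1+n 2) ⟩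
  3 * a  ∎))
  where
  open ≤-Reasoning
  twelve : ∀ a b → 3 * a ≡ b → 4 * (3 * a) ≡ 3 * (a + b)
  twelve a b refl = twelve′ a
    where
    twelve′ : ∀ a → 4 * (3 * a) ≡ 3 * (a + 3 * a)
    twelve′ = solve-∀

countBound-peel : ∀ p q r t {a b c} → 4 * r ≡ 3 * (p + q) → 3 * p ≡ q + 8 * t →
  (∀ {h} → 3 * (p + a) ≡ q + b + 8 * h → t ≤ h) →
  CountBound (p + a) (q + b) (r + c) → CountBound a b c
countBound-peel p q r t {a} {b} {c} 4r≡ 3p≡ t≤ (countBound D eq tight) = countBound D eq′ tight′
  where
  open ≡-Reasoning
  eq′ : 4 * c ≡ 3 * (a + b) + D
  eq′ = +-cancelˡ-≡ (4 * r) _ _ (begin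
    4 * r + 4 * c                    ≡⟨ *-distribˡ-+ 4 r c ⟨
    4 * (r + c)                      ≡⟨ eq ⟩
    3 * ((p + a) + (q + b)) + D      ≡⟨ regroup p q a b D ⟩
    3 * (p + q) + (3 * (a + b) + D)  ≡⟨ cong (_+ (3 * (a + b) + D)) 4r≡ ⟨
    4 * r + (3 * (a + b) + D)        ∎)
    where
    regroup : ∀ p q a b D → 3 * ((p + a) + (q + b)) + D ≡ 3 * (p + q) + (3 * (a + b) + D)
    regroup = solve-∀
  tight′ : D ≡ 0 → ∃[ h ] 3 * a ≡ b + 8 * h
  tight′ D≡0 with tight D≡0
  ... | h , e with m≤n⇒∃[o]m+o≡n (t≤ {h} e)
  ...   | h′ , refl = h′ , +-cancelˡ-≡ (3 * p) _ _ (begin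
    3 * p + 3 * a               ≡⟨ *-distribˡ-+ 3 p a ⟨
    3 * (p + a)                 ≡⟨ e ⟩
    q + b + 8 * (t + h′)        ≡⟨ regroup q b t h′ ⟩
    (q + 8 * t) + (b + 8 * h′)  ≡⟨ cong (_+ (b + 8 * h′)) 3p≡ ⟨
    3 * p + (b + 8 * h′)        ∎)
    where
    regroup : ∀ q b t h → q + b + 8 * (t + h) ≡ (q + 8 * t) + (b + 8 * h)
    regroup = solve-∀

private
  6+c<2*[4+a]⇒3+c<2*[3+a] : ∀ {c a} → 6 + c < 2 * (4 + a) → 3 + c < 2 * (3 + a)
  6+c<2*[4+a]⇒3+c<2*[3+a] {c} {a} lt = begin
    4 + c          ≤⟨ +-cancelˡ-≤ 3 (4 + c) (5 + 2 * a) (≤-trans lt (≤-reflexive (*-distribˡ-+ 2 4 a))) ⟩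
    5 + 2 * a      ≤⟨ n≤1+n _ ⟩
    6 + 2 * a      ≡⟨ *-distribˡ-+ 2 3 a ⟨
    2 * (3 + a)    ∎
    where open ≤-Reasoning

  2+c≤2*b⇒3+c<2*[1+b] : ∀ {c b} → 2 + c ≤ 2 * b → 3 + c < 2 * (1 + b)
  2+c≤2*b⇒3+c<2*[1+b] {c} {b} le = ≤-trans (+-monoʳ-≤ 2 le) (≤-reflexive (sym (*-distribˡ-+ 2 1 b)))

  c<a+b∧2*b≤1+c⇒c<2*a : ∀ {a b c} → c < a + b → 2 * b ≤ 1 + c → c < 2 * a
  c<a+b∧2*b≤1+c⇒c<2*a {a} {b} {c} c<a+b 2b≤ = +-cancelʳ-≤ (1 + c) (1 + c) (2 * a) (begin
    (1 + c) + (1 + c)  ≡⟨ cong (1 + c +_) (+-identityʳ (1 + c)) ⟨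
    2 * (1 + c)        ≤⟨ *-monoʳ-≤ 2 c<a+b ⟩
    2 * (a + b)        ≡⟨ *-distribˡ-+ 2 a b ⟩
    2 * a + 2 * b      ≤⟨ +-monoʳ-≤ (2 * a) 2b≤ ⟩
    2 * a + (1 + c)    ∎)
    where open ≤-Reasoning

realisable-pair : Realisable 4 4 6
realisable-pair = realisable-⊕ (realisable-fullRow ≤-refl) (realisable-fullColumn ≤-refl)

CountBoundRealisable : ℕ → Set
CountBoundRealisable c = ∀ {a b} → CountBound a b c → c < 2 * a → c < 2 * b → Realisable a b c

realisable-large : ∀ {a b c} → (∀ {c′} → c′ < 6 + c → CountBoundRealisable c′) →
  CountBound (4 + a) (4 + b) (6 + c) → 6 + c < 2 * (4 + a) → 6 + c < 2 * (4 + b) →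
  Realisable (4 + a) (4 + b) (6 + c)
realisable-large {a} {b} {c} ih cb c<2a c<2b with 2 + c ≤? 2 * b | 2 + c ≤? 2 * a
... | yes row | _ =
  realisable-⊕ (realisable-fullRow ≤-refl)
    (ih (+-monoˡ-< c (m<m+n 3 (s≤s z≤n))) (countBound-peel 1 3 3 0 refl refl (λ _ → z≤n) cb)
        (6+c<2*[4+a]⇒3+c<2*[3+a] {c} {a} c<2a) (2+c≤2*b⇒3+c<2*[1+b] {c} {b} row))
... | no _ | yes column =
  realisable-⊕ (realisable-fullColumn ≤-refl)
    (ih (+-monoˡ-< c (m<m+n 3 (s≤s z≤n)))
        (countBound-peel 3 1 3 1 refl refl (tight-witness-positive {4 + a} {4 + b} (countBound⇒≤ cb) c<2a) cb)
        (2+c≤2*b⇒3+c<2*[1+b] {c} {a} column) (6+c<2*[4+a]⇒3+c<2*[3+a] {c} {b} c<2b))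
... | no ¬row | no ¬column with a + b ≤? c
...   | yes a+b≤c =
  realisable-mono (≤-trans (≤-reflexive (regroup a b)) (+-monoʳ-≤ 6 a+b≤c))
    (realisable-twoLines (m≤m+n 3 a) (m≤m+n 3 b))
  where
  regroup : ∀ a b → (3 + a) + (3 + b) ≡ 6 + (a + b)
  regroup = solve-∀
...   | no a+b≰c =
  realisable-⊕ realisable-pair
    (ih (m<n+m c (s≤s z≤n))
        (countBound-peel 4 4 6 1 refl refl (tight-witness-positive {4 + a} {4 + b} (countBound⇒≤ cb) c<2a) cb)
        (c<a+b∧2*b≤1+c⇒c<2*a {a} {b} (≰⇒> a+b≰c) (≤-pred (≰⇒> ¬row)))
        (c<a+b∧2*b≤1+c⇒c<2*a {b} {a} (≤-trans (≰⇒> a+b≰c) (≤-reflexive (+-comm a b))) (≤-pred (≰⇒> ¬column))))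

SmallCase : ℕ → ℕ → ℕ → Set
SmallCase a b c = 3 * (a + b) ≤ 4 * c → c < 2 * a → c < 2 * b → a ≡ 3 × b ≡ 3 ⊎ a ≡ 2 × b ≡ 2 × c ≡ 3

smallCases : ∀ {a} → a < 7 → ∀ {b} → b < 7 → ∀ {c} → c < 6 → SmallCase a b c
smallCases = from-yes (allUpTo? (λ a → allUpTo? (λ b → allUpTo? (smallCase? a b) 6) 7) 7)
  where
  smallCase? : ∀ a b c → Dec (SmallCase a b c)
  smallCase? a b c = 3 * (a + b) ≤? 4 * c →-dec c <? 2 * a →-dec c <? 2 * b →-dec
                     ((a ≟ 3 ×-dec b ≟ 3) ⊎-dec (a ≟ 2 ×-dec b ≟ 2 ×-dec c ≟ 3))

private
  small-side : ∀ {a b c} → 3 * (a + b) ≤ 4 * c → c ≤ 5 → a < 7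
  small-side {a} {b} ≤4c c≤5 = *-cancelˡ-< 3 a 7 (s≤s (≤-trans (*-monoʳ-≤ 3 (m≤m+n a b)) (≤-trans ≤4c (*-monoʳ-≤ 4 c≤5))))

  ¬countBound-2-2-3 : ¬ CountBound 2 2 3
  ¬countBound-2-2-3 (countBound _ refl tight) with tight refl
  ... | zero  , ()
  ... | suc h , 6≡ = ≤⇒≯ (≤-trans (+-monoʳ-≤ 2 (*-monoʳ-≤ 8 (s≤s z≤n))) (≤-reflexive (sym 6≡))) (m<m+n 6 (s≤s z≤n))

realisable-smallCase : ∀ {a b c} → CountBound a b c → a ≡ 3 × b ≡ 3 ⊎ a ≡ 2 × b ≡ 2 × c ≡ 3 → Realisable a b c
realisable-smallCase cb (inj₁ (refl , refl)) =
  realisable-mono (*-cancelˡ-< 4 4 _ (≤-trans (n≤1+n 17) (countBound⇒≤ cb))) realisable-tee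
realisable-smallCase cb (inj₂ (refl , refl , refl)) = ⊥-elim (¬countBound-2-2-3 cb)

realisable-small : ∀ {a b c} → c ≤ 5 → CountBound a b c → c < 2 * a → c < 2 * b → Realisable a b c
realisable-small {a} {b} {c} c≤5 cb c<2a c<2b = realisable-smallCase cb
  (smallCases (small-side ≤4c c≤5) (small-side (≤-trans (≤-reflexive (cong (3 *_) (+-comm b a))) ≤4c) c≤5)
              (s≤s c≤5) ≤4c c<2a c<2b)
  where ≤4c = countBound⇒≤ cb

realisable : ∀ c → CountBoundRealisable c
realisable = <-rec CountBoundRealisable step
  where
  step : ∀ c → (∀ {c′} → c′ < c → CountBoundRealisable c′) → CountBoundRealisable c
  step c ih {a} {b} cb c<2a c<2b with c ≤? 5
  ... | yes c≤5 = realisable-small c≤5 cb c<2a c<2b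
  ... | no c≰5 with m≤n⇒∃[o]m+o≡n (≰⇒> c≰5)
  ...   | c′ , refl with m≤n⇒∃[o]m+o≡n (4≤ {a} c<2a) | m≤n⇒∃[o]m+o≡n (4≤ {b} c<2b)
    where
    4≤ : ∀ {x} → 6 + c′ < 2 * x → 4 ≤ x
    4≤ {x} lt = *-cancelˡ-< 2 3 x (≤-trans (s≤s (+-monoʳ-≤ 6 z≤n)) lt)
  ...     | a′ , refl | b′ , refl = realisable-large ih cb c<2a c<2b

-- Splitting off K_4 □ K_4

γ≤realisable : ∀ {a b γ c} → IsGamma2t a b γ → Realisable a b c → γ ≤ c
γ≤realisable (_ , minimal) (S , dom , _ , card≤) = ≤-trans (minimal S (rowColDominating⇒total2Dom S dom)) card≤

γ≤2*rows : ∀ {a b γ} → IsGamma2t a b γ → 2 ≤ a → 2 ≤ b → γ ≤ 2 * a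
γ≤2*rows {a} {suc (suc b)} (_ , minimal) 2≤a _ =
  ≤-trans (minimal _ (twoColumns-total2Dom b 2≤a)) (≤-reflexive (trans (card-twoColumns a b) (*-comm a 2)))
γ≤2*rows {b = 1} _ _ (s≤s ())

countBound-peel-pair : ∀ {a b g} → a ≤ b → CountBound (4 + a) (4 + b) g → 2 + g < 2 * (4 + a) →
  ∃[ c ] g ≡ 6 + c × Realisable a b c
countBound-peel-pair {a} {b} {g} a≤b cb narrow with m≤n⇒∃[o]m+o≡n 6≤g
  where
  6≤g : 6 ≤ g
  6≤g = *-cancelˡ-≤ 4 (≤-trans (*-monoʳ-≤ 3 (+-mono-≤ (m≤m+n 4 a) (m≤m+n 4 b))) (countBound⇒≤ cb))
... | c , refl = c , refl , realisable c cb′ c<2a (≤-trans c<2a (*-monoʳ-≤ 2 a≤b))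
  where
  c<2a : c < 2 * a
  c<2a = +-cancelˡ-≤ 8 (1 + c) (2 * a) (≤-trans narrow (≤-reflexive (*-distribˡ-+ 2 4 a)))
  cb′ : CountBound a b c
  cb′ = countBound-peel 4 4 6 1 refl refl
          (tight-witness-positive {4 + a} {4 + b} (countBound⇒≤ cb) (≤-trans (m≤n+m (7 + c) 2) narrow)) cb

γ-lowerBound : ∀ {n m γ} → IsGamma2t n m γ → n ≤ m → 2 * n ≤ γ ⊎ CountBound n m γ
γ-lowerBound {n} {m} ((S , S-dom , card≡) , _) n≤m =
  subst (λ k → 2 * n ≤ k ⊎ CountBound n m k) card≡ (lowerBound S (total2Dom⇒rowColDominating S S-dom) n≤m)

γ-split-pair : ∀ {a b g g₄₄ g₄} → 2 ≤ a → a ≤ b →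
  IsGamma2t (4 + a) (4 + b) g → IsGamma2t 4 4 g₄₄ → IsGamma2t a b g₄ → g₄₄ + g₄ ≤ g
γ-split-pair {a} {b} {g} 2≤a a≤b γ γ₄₄ γ₄ with 2 * (4 + a) ≤? 2 + g
... | yes wide =
  ≤-trans (+-mono-≤ (γ≤realisable γ₄₄ realisable-pair) (γ≤2*rows γ₄ 2≤a (≤-trans 2≤a a≤b)))
          (+-cancelˡ-≤ 2 (6 + 2 * a) g (≤-trans (≤-reflexive (sym (*-distribˡ-+ 2 4 a))) wide))
... | no narrow with γ-lowerBound γ (+-monoʳ-≤ 4 a≤b)
...   | inj₁ 2n≤g = ⊥-elim (narrow (≤-trans 2n≤g (m≤n+m g 2)))
...   | inj₂ cb with countBound-peel-pair a≤b cb (≰⇒> narrow)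
...     | c , refl , realisable-c = +-mono-≤ (γ≤realisable γ₄₄ realisable-pair) (γ≤realisable γ₄ realisable-c)

theorem2p9 : (n m : ℕ) → 6 ≤ n → n ≤ m →
    (g g33 g44 g3 g4 : ℕ) →
    IsGamma2t n m g → IsGamma2t 3 3 g33 → IsGamma2t 4 4 g44 →
    IsGamma2t (n ∸ 3) (m ∸ 3) g3 → IsGamma2t (n ∸ 4) (m ∸ 4) g4 →
    (g33 + g3) ⊓ (g44 + g4) ≤ g
theorem2p9 (suc (suc (suc (suc n)))) (suc (suc (suc (suc m)))) (s≤s (s≤s (s≤s (s≤s 2≤n)))) (s≤s (s≤s (s≤s (s≤s n≤m))))
           g g33 g44 g3 g4 γ _ γ₄₄ _ γ₄ =
  ≤-trans (m⊓n≤n (g33 + g3) (g44 + g4)) (γ-split-pair 2≤n n≤m γ γ₄₄ γ₄)
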